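{- For every integer $m>1$, $v_p(G_m)\ge v_{cs}(G_{\lfloor m/2\rfloor})$.
   Context: $G_m$ is the $m\times m$ grid graph: vertex set $\{0,\dots,m-1\}^2$, with $(x_1,y_1)$ and $(x_2,y_2)$ adjacent iff $|x_1-x_2|+|y_1-y_2|=1$. For a vertex set $V'$, $G[V']$ is the induced subgraph; a path is a simple path (a single vertex counts). Connected component game on a graph $G$: set $i=0$, $G^0=G$; while $V(G^i)\neq\emptyset$: increase $i$ by 1, player 1 chooses (the vertex set $S^i$ of) a connected component of $G^{i-1}$, player 2 chooses $v_i\in S^i$, and $G^i=G^{i-1}[S^i\setminus\{v_i\}]$. The path game is identical except that player 1 chooses the vertex set $S^i$ of a path of $G^{i-1}$. In each game the result is the final value of $i$, player 1 maximizes and player 2 minimizes it; $v_{cs}(G)$ and $v_p(G)$ denote the results under optimal play of the connected component game and the path game, respectively. -}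

module Defs where

open import Level using (0ℓ)
open import Data.Nat using (ℕ; zero; suc; _+_; _<_; ∣_-_∣)
open import Data.Product using (_×_; _,_; Σ; ∃)
open import Data.Unit.Polymorphic using (⊤)
open import Data.List using (List; [])
open import Data.List.Membership.Propositional using (_∈_)
open import Data.List.Relation.Unary.All using (All)
open import Data.List.Relation.Unary.Linked using (Linked)
open import Data.List.Relation.Unary.Unique.Propositional using (Unique)
open import Relation.Binary.PropositionalEquality using (_≡_; _≢_)
open import Relation.Unary using (Pred)
open import Relation.Nullary using (¬_)
open import Function.Bundles using (_⇔_)

V : Set
V = ℕ × ℕ

VSet : Set₁
VSet = Pred V 0ℓ

Adj : V → V → Set
Adj (x₁ , y₁) (x₂ , y₂) = ∣ x₁ - x₂ ∣ + ∣ y₁ - y₂ ∣ ≡ 1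

Grid : ℕ → VSet
Grid m (x , y) = (x < m) × (y < m)

_∖_ : VSet → V → VSet
(S ∖ v) u = S u × (u ≢ v)

data Reach (C : VSet) : V → V → Set where
  here : ∀ {u} → C u → Reach C u u
  step : ∀ {u w z} → C u → Adj u w → Reach C w z → Reach C u z

IsComponent : VSet → VSet → Set
IsComponent S C =
  (∀ u → C u → S u) ×
  (∃ λ u → C u) ×
  (∀ u w → C u → C w → Reach C u w) ×
  (∀ u w → C u → S w → Adj u w → C w)

IsPath : VSet → VSet → Set
IsPath S C =
  Σ (List V) λ p →
    (p ≢ []) × Unique p × All S p × Linked Adj p × (∀ u → C u ⇔ (u ∈ p))

-- Guarantees Move S k : in the game where player 1 picks a set C with Move S C
-- (current vertex set S), player 2 picks v ∈ C and the game continues on C \ {v},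
-- player 1 can force the result (number of rounds) to be at least k.
Guarantees : (VSet → VSet → Set) → VSet → ℕ → Set₁
Guarantees Move S zero    = ⊤
Guarantees Move S (suc k) =
  Σ VSet λ C → Move S C × (∀ v → C v → Guarantees Move (C ∖ v) k)

vcs≥ : VSet → ℕ → Set₁
vcs≥ = Guarantees IsComponent

vp≥ : VSet → ℕ → Set₁
vp≥ = Guarantees IsPath

module Submission where

-- Every vertex c of G_⌊m/2⌋ stands for the 2×2 block of cells of G_m whose coordinates halve
-- to c. The blow-up of a finite connected set C of blocks has a Hamiltonian path: start with
-- the 4-cycle through a leftmost block and add the remaining blocks of C one at a time, each
-- next to an earlier one, splicing the four cells of the new block into the cycle in place of
-- the edge along the side it shares with that earlier block. Player 1 answers every component
-- C chosen by an optimal strategy on G_⌊m/2⌋ with this path in G_m; when player 2 deletes a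
-- cell v, the rest of the path still contains the blow-up of C minus the block of v, so the
-- simulation continues there and every simulated round is matched by a round of the path game.

open import Defs
open import Data.Nat using (ℕ; _<_)
open import Data.Nat.DivMod using (_/_)

open import Data.Empty using (⊥-elim)
open import Data.List.Base using (List; []; _∷_; _++_; [_]; map; length; cartesianProduct; upTo)
open import Data.List.Extrema.Nat using (argmin; argmin-all; f[argmin]≤f[xs])
open import Data.List.Membership.Propositional using (_∈_; _∉_; find; lose)
open import Data.List.Membership.Propositional.Properties
  using (∈-map⁺; ∈-map⁻; ∈-++⁻; ∈-++⁺ˡ; ∈-++⁺ʳ; ∈-∃++; ∈-cartesianProduct⁺; ∈-upTo⁺)
open import Data.List.Properties using (length-++)
open import Data.List.Relation.Binary.Disjoint.Propositional using (Disjoint)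
open import Data.List.Relation.Binary.Permutation.Propositional using (_↭_; prep; ↭-sym; ↭-trans; ↭⇒↭ₛ)
open import Data.List.Relation.Binary.Permutation.Propositional.Properties using (shift; ∈-resp-↭)
import Data.List.Relation.Binary.Permutation.Setoid.Properties as ↭ₛ
open import Data.List.Relation.Unary.All using ([]; _∷_)
import Data.List.Relation.Unary.All as All
open import Data.List.Relation.Unary.All.Properties.Core using (¬Any⇒All¬)
open import Data.List.Relation.Unary.AllPairs using ([]; _∷_)
open import Data.List.Relation.Unary.Any using (Any; here; there; any?)
open import Data.List.Relation.Unary.Linked using (Linked; [-]; _∷_)
import Data.List.Relation.Unary.Linked as Linked
open import Data.List.Relation.Unary.Unique.Propositional using (Unique)
import Data.List.Relation.Unary.Unique.Propositional.Properties as Unique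
open import Data.Nat.Base using (zero; suc; _+_; _*_; _≤_; _∸_; z≤n; s≤s; ∣_-_∣; ⌊_/2⌋; parity)
open import Data.Nat.DivMod using (m/n*n≤m)
open import Data.Nat.Properties
  using (_≟_; _<?_; ∣n-n∣≡0; ∣m-n∣≡0⇒m≡n; ∣-∣-comm; 1+n≰n; <⇒≱; n<1+n; +-identityʳ; +-suc;
         ≤-trans; ≤-reflexive; module ≤-Reasoning)
open import Data.Parity.Base using (Parity; 0ℙ; 1ℙ)
open import Data.Product.Base using (_×_; _,_; proj₁; proj₂; ∃)
open import Data.Product.Properties using (≡-dec)
open import Data.Sum.Base using (_⊎_; inj₁; inj₂)
open import Function.Bundles using (mk⇔)
open import Function.Properties.Equivalence using () renaming (sym to ⇔-sym)
open import Relation.Binary.Definitions using (DecidableEquality)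
open import Relation.Binary.PropositionalEquality
  using (_≡_; _≢_; refl; sym; trans; cong; cong₂; subst; setoid)
open import Relation.Nullary.Decidable using (Dec; yes; no; _×-dec_; ¬?)
import Relation.Nullary.Decidable as Dec
open import Relation.Unary using (Decidable; _⊆_)

private variable
  x y : ℕ
  a b c d u : V

-- Blocks and corners

double : ℕ → ℕ
double zero    = zero
double (suc n) = suc (suc (double n))

cellCoord : ℕ → Parity → ℕ
cellCoord n 0ℙ = double n
cellCoord n 1ℙ = suc (double n)

cellCoord-suc : ∀ n p → cellCoord (suc n) p ≡ suc (suc (cellCoord n p))
cellCoord-suc n 0ℙ = refl
cellCoord-suc n 1ℙ = refl

⌊cellCoord/2⌋≡ : ∀ n p → ⌊ cellCoord n p /2⌋ ≡ n
⌊cellCoord/2⌋≡ zero    0ℙ = refl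
⌊cellCoord/2⌋≡ zero    1ℙ = refl
⌊cellCoord/2⌋≡ (suc n) p  = trans (cong ⌊_/2⌋ (cellCoord-suc n p)) (cong suc (⌊cellCoord/2⌋≡ n p))

parity[cellCoord]≡ : ∀ n p → parity (cellCoord n p) ≡ p
parity[cellCoord]≡ zero    0ℙ = refl
parity[cellCoord]≡ zero    1ℙ = refl
parity[cellCoord]≡ (suc n) p  = trans (cong parity (cellCoord-suc n p)) (parity[cellCoord]≡ n p)

cellCoord[⌊n/2⌋,parity[n]]≡n : ∀ n → cellCoord ⌊ n /2⌋ (parity n) ≡ n
cellCoord[⌊n/2⌋,parity[n]]≡n zero          = refl
cellCoord[⌊n/2⌋,parity[n]]≡n (suc zero)    = refl
cellCoord[⌊n/2⌋,parity[n]]≡n (suc (suc n)) =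
  trans (cellCoord-suc ⌊ n /2⌋ (parity n)) (cong (λ m → suc (suc m)) (cellCoord[⌊n/2⌋,parity[n]]≡n n))

Corner : Set
Corner = Parity × Parity

pattern sw = 0ℙ , 0ℙ
pattern se = 1ℙ , 0ℙ
pattern ne = 1ℙ , 1ℙ
pattern nw = 0ℙ , 1ℙ

cell : V → Corner → V
cell (x , y) (p , q) = cellCoord x p , cellCoord y q

block : V → V
block (x , y) = ⌊ x /2⌋ , ⌊ y /2⌋

corner : V → Corner
corner (x , y) = parity x , parity y

blowUp : VSet → VSet
blowUp C u = C (block u)

block-cell : ∀ c k → block (cell c k) ≡ c
block-cell (x , y) (p , q) = cong₂ _,_ (⌊cellCoord/2⌋≡ x p) (⌊cellCoord/2⌋≡ y q)

corner-cell : ∀ c k → corner (cell c k) ≡ k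
corner-cell (x , y) (p , q) = cong₂ _,_ (parity[cellCoord]≡ x p) (parity[cellCoord]≡ y q)

cell-block-corner : ∀ u → cell (block u) (corner u) ≡ u
cell-block-corner (x , y) = cong₂ _,_ (cellCoord[⌊n/2⌋,parity[n]]≡n x) (cellCoord[⌊n/2⌋,parity[n]]≡n y)

cell-injective : ∀ c {k l} → cell c k ≡ cell c l → k ≡ l
cell-injective c {k} {l} e = trans (sym (corner-cell c k)) (trans (cong corner e) (corner-cell c l))

∈-map-cell⁻ : ∀ ks → u ∈ map (cell c) ks → block u ≡ c
∈-map-cell⁻ {c = c} _ u∈ with ∈-map⁻ (cell c) u∈
... | k , _ , refl = block-cell c k

∈-map-cell⁺ : ∀ ks → block u ≡ c → corner u ∈ ks → u ∈ map (cell c) ks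
∈-map-cell⁺ {u} ks refl k∈ = subst (_∈ map (cell (block u)) ks) (cell-block-corner u) (∈-map⁺ (cell (block u)) k∈)

Decidable[blowUp]⇒Decidable : ∀ {C} → Decidable (blowUp C) → Decidable C
Decidable[blowUp]⇒Decidable {C} C⇑? u =
  Dec.map′ (subst C (block-cell u sw)) (subst C (sym (block-cell u sw))) (C⇑? (cell u sw))

turn : Corner → Corner
turn sw = se
turn se = ne
turn ne = nw
turn nw = sw

around : Corner → List Corner
around k = k ∷ turn k ∷ turn (turn k) ∷ turn (turn (turn k)) ∷ []

around-unique : ∀ k → Unique (around k)
around-unique sw = ((λ ()) ∷ (λ ()) ∷ (λ ()) ∷ []) ∷ ((λ ()) ∷ (λ ()) ∷ []) ∷ ((λ ()) ∷ []) ∷ [] ∷ []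
around-unique se = ((λ ()) ∷ (λ ()) ∷ (λ ()) ∷ []) ∷ ((λ ()) ∷ (λ ()) ∷ []) ∷ ((λ ()) ∷ []) ∷ [] ∷ []
around-unique ne = ((λ ()) ∷ (λ ()) ∷ (λ ()) ∷ []) ∷ ((λ ()) ∷ (λ ()) ∷ []) ∷ ((λ ()) ∷ []) ∷ [] ∷ []
around-unique nw = ((λ ()) ∷ (λ ()) ∷ (λ ()) ∷ []) ∷ ((λ ()) ∷ (λ ()) ∷ []) ∷ ((λ ()) ∷ []) ∷ [] ∷ []

∈-around : ∀ k l → l ∈ around k
∈-around sw sw = here refl
∈-around sw se = there (here refl)
∈-around sw ne = there (there (here refl))
∈-around sw nw = there (there (there (here refl)))
∈-around se se = here refl
∈-around se ne = there (here refl)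
∈-around se nw = there (there (here refl))
∈-around se sw = there (there (there (here refl)))
∈-around ne ne = here refl
∈-around ne nw = there (here refl)
∈-around ne sw = there (there (here refl))
∈-around ne se = there (there (there (here refl)))
∈-around nw nw = here refl
∈-around nw sw = there (here refl)
∈-around nw se = there (there (here refl))
∈-around nw ne = there (there (there (here refl)))

data Neighbour : V → V → Set where
  right : Neighbour (x , y) (suc x , y)
  left  : Neighbour (suc x , y) (x , y)
  up    : Neighbour (x , y) (x , suc y)
  down  : Neighbour (x , suc y) (x , y)

∣n-1+n∣≡1 : ∀ n → ∣ n - suc n ∣ ≡ 1
∣n-1+n∣≡1 zero    = refl
∣n-1+n∣≡1 (suc n) = ∣n-1+n∣≡1 n

∣1+n-n∣≡1 : ∀ n → ∣ suc n - n ∣ ≡ 1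
∣1+n-n∣≡1 n = trans (∣-∣-comm (suc n) n) (∣n-1+n∣≡1 n)

Neighbour⇒Adj : Neighbour a b → Adj a b
Neighbour⇒Adj (right {x} {y}) = cong₂ _+_ (∣n-1+n∣≡1 x) (∣n-n∣≡0 y)
Neighbour⇒Adj (left  {x} {y}) = cong₂ _+_ (∣1+n-n∣≡1 x) (∣n-n∣≡0 y)
Neighbour⇒Adj (up    {x} {y}) = cong₂ _+_ (∣n-n∣≡0 x) (∣n-1+n∣≡1 y)
Neighbour⇒Adj (down  {x} {y}) = cong₂ _+_ (∣n-n∣≡0 x) (∣1+n-n∣≡1 y)

∣m-n∣≡1⇒n≡1+m⊎m≡1+n : ∀ m n → ∣ m - n ∣ ≡ 1 → n ≡ suc m ⊎ m ≡ suc n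
∣m-n∣≡1⇒n≡1+m⊎m≡1+n zero          (suc zero)    _ = inj₁ refl
∣m-n∣≡1⇒n≡1+m⊎m≡1+n (suc zero)    zero          _ = inj₂ refl
∣m-n∣≡1⇒n≡1+m⊎m≡1+n (suc m)       (suc n)       e with ∣m-n∣≡1⇒n≡1+m⊎m≡1+n m n e
... | inj₁ n≡1+m = inj₁ (cong suc n≡1+m)
... | inj₂ m≡1+n = inj₂ (cong suc m≡1+n)
∣m-n∣≡1⇒n≡1+m⊎m≡1+n zero          zero          ()
∣m-n∣≡1⇒n≡1+m⊎m≡1+n zero          (suc (suc n)) ()
∣m-n∣≡1⇒n≡1+m⊎m≡1+n (suc (suc m)) zero          ()

m+n≡1⇒m≡0∧n≡1⊎m≡1∧n≡0 : ∀ m n → m + n ≡ 1 → (m ≡ 0 × n ≡ 1) ⊎ (m ≡ 1 × n ≡ 0)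
m+n≡1⇒m≡0∧n≡1⊎m≡1∧n≡0 zero          n       e = inj₁ (refl , e)
m+n≡1⇒m≡0∧n≡1⊎m≡1∧n≡0 (suc zero)    zero    _ = inj₂ (refl , refl)
m+n≡1⇒m≡0∧n≡1⊎m≡1∧n≡0 (suc zero)    (suc n) ()
m+n≡1⇒m≡0∧n≡1⊎m≡1∧n≡0 (suc (suc m)) n       ()

Adj⇒Neighbour : ∀ a b → Adj a b → Neighbour a b
Adj⇒Neighbour (x₁ , y₁) (x₂ , y₂) e with m+n≡1⇒m≡0∧n≡1⊎m≡1∧n≡0 ∣ x₁ - x₂ ∣ ∣ y₁ - y₂ ∣ e
... | inj₁ (dx≡0 , dy≡1) with ∣m-n∣≡0⇒m≡n {x₁} dx≡0 | ∣m-n∣≡1⇒n≡1+m⊎m≡1+n y₁ y₂ dy≡1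
...   | refl | inj₁ refl = up
...   | refl | inj₂ refl = down
Adj⇒Neighbour (x₁ , y₁) (x₂ , y₂) e | inj₂ (dx≡1 , dy≡0) with ∣m-n∣≡0⇒m≡n {y₁} dy≡0 | ∣m-n∣≡1⇒n≡1+m⊎m≡1+n x₁ x₂ dx≡1
...   | refl | inj₁ refl = right
...   | refl | inj₂ refl = left

-- Splicing a list in between two consecutive entries

module _ {A : Set} where

  data Consecutive (a b : A) : List A → Set where
    here  : ∀ {xs} → Consecutive a b (a ∷ b ∷ xs)
    there : ∀ {x xs} → Consecutive a b xs → Consecutive a b (x ∷ xs)

  splice : ∀ {a b : A} {xs} → Consecutive a b xs → List A → List A
  splice {a} {b} (here {xs}) is = a ∷ is ++ b ∷ xs
  splice (there {x} q)       is = x ∷ splice q is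

  Consecutive-++ˡ : ∀ {a b : A} is {xs} → Consecutive a b xs → Consecutive a b (is ++ xs)
  Consecutive-++ˡ []       q = q
  Consecutive-++ˡ (i ∷ is) q = there (Consecutive-++ˡ is q)

  Consecutive-++ʳ : ∀ {a b : A} {is} xs → Consecutive a b is → Consecutive a b (is ++ xs)
  Consecutive-++ʳ xs here      = here
  Consecutive-++ʳ xs (there q) = there (Consecutive-++ʳ xs q)

  splice≢[] : ∀ {a b : A} {xs} (q : Consecutive a b xs) is → splice q is ≢ []
  splice≢[] here      is ()
  splice≢[] (there q) is ()

  splice-↭ : ∀ {a b : A} {xs} (q : Consecutive a b xs) is → splice q is ↭ is ++ xs
  splice-↭ {a} {b} (here {xs}) is = ↭-sym (shift a is (b ∷ xs))
  splice-↭ (there {x} {xs} q)  is = ↭-trans (prep x (splice-↭ q is)) (↭-sym (shift x is xs))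

  splice-inserted : ∀ {a b c d : A} {xs is} (q : Consecutive a b xs) →
                    Consecutive c d is → Consecutive c d (splice q is)
  splice-inserted here      r = there (Consecutive-++ʳ _ r)
  splice-inserted (there q) r = there (splice-inserted q r)

  splice-kept : ∀ {a b c d : A} {xs is} (q : Consecutive a b xs) →
                Consecutive c d xs → c ≢ a → Consecutive c d (splice q is)
  splice-kept here              here      c≢a = ⊥-elim (c≢a refl)
  splice-kept (there here)      here      _   = here
  splice-kept (there (there q)) here      _   = here
  splice-kept {is = is} here    (there r) _   = there (Consecutive-++ˡ is r)
  splice-kept (there q)         (there r) c≢a = there (splice-kept q r c≢a)

  module _ {R : A → A → Set} where

    Linked-join : ∀ {a b : A} is {xs} → Linked R (a ∷ is ++ [ b ]) → Linked R (b ∷ xs) →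
                  Linked R (a ∷ is ++ b ∷ xs)
    Linked-join []       (r ∷ [-]) l  = r ∷ l
    Linked-join (i ∷ is) (r ∷ l)   l′ = r ∷ Linked-join is l l′

    splice-linked : ∀ {a b : A} {xs is} (q : Consecutive a b xs) →
                    Linked R xs → Linked R (a ∷ is ++ [ b ]) → Linked R (splice q is)
    splice-linked {is = is} here    (_ ∷ l) d = Linked-join is d l
    splice-linked (there here)      (r ∷ l) d = r ∷ splice-linked here l d
    splice-linked (there (there q)) (r ∷ l) d = r ∷ splice-linked (there q) l d

Consecutive-map : ∀ {A B : Set} (f : A → B) {a b xs} → Consecutive a b xs → Consecutive (f a) (f b) (map f xs)
Consecutive-map f here      = here
Consecutive-map f (there q) = there (Consecutive-map f q)

-- Hamiltonian paths in blown-up sets of blocks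

-- Counterclockwise around c, the side of c facing a runs from the cell at corner facing s
-- to the cell at turn (facing s); the first of them is adjacent to the cell of a at entry s.
entry : Neighbour c a → Corner
entry right = sw
entry up    = se
entry left  = ne
entry down  = nw

facing : Neighbour c a → Corner
facing s = turn (entry s)

sideStart sideEnd : Neighbour c a → V
sideStart {c} s = cell c (facing s)
sideEnd   {c} s = cell c (turn (facing s))

detour : Neighbour c a → List V
detour {a = a} s = map (cell a) (around (entry s))

∈-detour⁻ : (s : Neighbour c a) → u ∈ detour s → block u ≡ a
∈-detour⁻ s = ∈-map-cell⁻ (around (entry s))

∈-detour⁺ : (s : Neighbour c a) → block u ≡ a → u ∈ detour s
∈-detour⁺ {u = u} s bu≡a = ∈-map-cell⁺ (around (entry s)) bu≡a (∈-around (entry s) (corner u))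

detour-unique : (s : Neighbour c a) → Unique (detour s)
detour-unique {a = a} s = Unique.map⁺ (cell-injective a) (around-unique (entry s))

detour-linked : (s : Neighbour c a) → Linked Neighbour (sideStart s ∷ detour s ++ [ sideEnd s ])
detour-linked right = right ∷ right ∷ up ∷ left ∷ left ∷ [-]
detour-linked up    = up ∷ up ∷ left ∷ down ∷ down ∷ [-]
detour-linked left  = left ∷ left ∷ down ∷ right ∷ right ∷ [-]
detour-linked down  = down ∷ down ∷ right ∷ up ∷ up ∷ [-]

around-side : (s : Neighbour c a) (t : Neighbour a b) → b ≢ c →
              Consecutive (facing t) (turn (facing t)) (around (entry s))
around-side right right _   = there here
around-side right up    _   = there (there here)
around-side right down  _   = here
around-side right left  b≢c = ⊥-elim (b≢c refl)
around-side up    right _   = here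
around-side up    up    _   = there here
around-side up    left  _   = there (there here)
around-side up    down  b≢c = ⊥-elim (b≢c refl)
around-side left  up    _   = here
around-side left  left  _   = there here
around-side left  down  _   = there (there here)
around-side left  right b≢c = ⊥-elim (b≢c refl)
around-side down  left  _   = here
around-side down  down  _   = there here
around-side down  right _   = there (there here)
around-side down  up    b≢c = ⊥-elim (b≢c refl)

detour-side : (s : Neighbour c a) (t : Neighbour a b) → b ≢ c → Consecutive (sideStart t) (sideEnd t) (detour s)
detour-side {a = a} s t b≢c = Consecutive-map (cell a) (around-side s t b≢c)

across : V → Corner → V
across (x , y) sw = x , y ∸ 1
across (x , y) se = suc x , y
across (x , y) ne = x , suc y
across (x , y) nw = x ∸ 1 , y

across-facing : (s : Neighbour c a) → across c (facing s) ≡ a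
across-facing right = refl
across-facing up    = refl
across-facing left  = refl
across-facing down  = refl

across-sideStart : (s : Neighbour c a) → across (block (sideStart s)) (corner (sideStart s)) ≡ a
across-sideStart {c} s rewrite block-cell c (facing s) | corner-cell c (facing s) = across-facing s

sideStart-injective : (s : Neighbour c a) (t : Neighbour d b) → sideStart s ≡ sideStart t → a ≡ b
sideStart-injective s t e =
  trans (sym (across-sideStart s)) (trans (cong (λ u → across (block u) (corner u)) e) (across-sideStart t))

Unique-resp-↭ : ∀ {xs ys : List V} → xs ↭ ys → Unique xs → Unique ys
Unique-resp-↭ xs↭ys = ↭ₛ.Unique-resp-↭ (setoid V) (↭⇒↭ₛ xs↭ys)

-- path is the blown-up cycle around L cut open along the west side of its first block,
-- which is why sides facing blocks west of x₀ are exempt.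
record BlockTour (x₀ : ℕ) (L : List V) : Set where
  field
    path     : List V
    nonempty : path ≢ []
    unique   : Unique path
    linked   : Linked Neighbour path
    block∈   : ∀ {u} → u ∈ path → block u ∈ L
    ∈path    : ∀ {u} → block u ∈ L → u ∈ path
    side     : ∀ {c a} (s : Neighbour c a) → c ∈ L → a ∉ L → x₀ ≤ proj₁ a →
               Consecutive (sideStart s) (sideEnd s) path

rootTour : ∀ r → BlockTour (proj₁ r) [ r ]
rootTour r@(x , y) = record
  { path     = map (cell r) (around sw)
  ; nonempty = λ ()
  ; unique   = Unique.map⁺ (cell-injective r) (around-unique sw)
  ; linked   = right ∷ up ∷ left ∷ [-]
  ; block∈   = λ u∈ → here (∈-map-cell⁻ (around sw) u∈)
  ; ∈path    = λ { (here e) → ∈-map-cell⁺ (around sw) e (∈-around sw _) }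
  ; side     = side
  }
  where
  side : ∀ {c a} (s : Neighbour c a) → c ∈ [ r ] → a ∉ [ r ] → x ≤ proj₁ a →
         Consecutive (sideStart s) (sideEnd s) (map (cell r) (around sw))
  side right (here refl) _ _   = there here
  side up    (here refl) _ _   = there (there here)
  side down  (here refl) _ _   = here
  side left  (here refl) _ x≤a = ⊥-elim (1+n≰n x≤a)

extendTour : ∀ {x₀ L c a} → BlockTour x₀ L → c ∈ L → (s : Neighbour c a) → a ∉ L → x₀ ≤ proj₁ a →
             BlockTour x₀ (a ∷ L)
extendTour {x₀} {L} {c} {a} K c∈L s a∉L x₀≤a = record
  { path     = path′
  ; nonempty = splice≢[] q (detour s)
  ; unique   = Unique-resp-↭ (↭-sym path′↭) (Unique.++⁺ (detour-unique s) unique disjoint)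
  ; linked   = splice-linked q linked (detour-linked s)
  ; block∈   = block∈′
  ; ∈path    = ∈path′
  ; side     = side′
  }
  where
  open BlockTour K
  q : Consecutive (sideStart s) (sideEnd s) path
  q = side s c∈L a∉L x₀≤a
  path′ : List V
  path′ = splice q (detour s)
  path′↭ : path′ ↭ detour s ++ path
  path′↭ = splice-↭ q (detour s)
  disjoint : Disjoint (detour s) path
  disjoint (u∈detour , u∈path) = a∉L (subst (_∈ L) (∈-detour⁻ s u∈detour) (block∈ u∈path))
  block∈′ : ∀ {u} → u ∈ path′ → block u ∈ a ∷ L
  block∈′ u∈ with ∈-++⁻ (detour s) (∈-resp-↭ path′↭ u∈)
  ... | inj₁ u∈detour = here (∈-detour⁻ s u∈detour)
  ... | inj₂ u∈path   = there (block∈ u∈path)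
  ∈path′ : ∀ {u} → block u ∈ a ∷ L → u ∈ path′
  ∈path′ (here bu≡a) = ∈-resp-↭ (↭-sym path′↭) (∈-++⁺ˡ (∈-detour⁺ s bu≡a))
  ∈path′ (there bu∈) = ∈-resp-↭ (↭-sym path′↭) (∈-++⁺ʳ (detour s) (∈path bu∈))
  side′ : ∀ {d b} (t : Neighbour d b) → d ∈ a ∷ L → b ∉ a ∷ L → x₀ ≤ proj₁ b →
          Consecutive (sideStart t) (sideEnd t) path′
  side′ t (here refl) b∉ _    = splice-inserted q (detour-side s t λ { refl → b∉ (there c∈L) })
  side′ t (there d∈L) b∉ x₀≤b =
    splice-kept q (side t d∈L (λ b∈ → b∉ (there b∈)) x₀≤b) (λ e → b∉ (here (sideStart-injective t s e)))

data Growth (x₀ : ℕ) (r : V) : List V → Set where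
  root : Growth x₀ r [ r ]
  grow : ∀ {L c a} → Growth x₀ r L → c ∈ L → Neighbour c a → a ∉ L → x₀ ≤ proj₁ a → Growth x₀ r (a ∷ L)

Growth⇒BlockTour : ∀ {r L} → Growth (proj₁ r) r L → BlockTour (proj₁ r) L
Growth⇒BlockTour {r} root                  = rootTour r
Growth⇒BlockTour (grow g c∈L s a∉L x₀≤a) = extendTour (Growth⇒BlockTour g) c∈L s a∉L x₀≤a

Growth⇒Unique : ∀ {x₀ r L} → Growth x₀ r L → Unique L
Growth⇒Unique root                    = [] ∷ []
Growth⇒Unique (grow {L} g _ _ a∉L _) = ¬Any⇒All¬ L a∉L ∷ Growth⇒Unique g

root∈ : ∀ {x₀ r L} → Growth x₀ r L → r ∈ L
root∈ root             = here refl
root∈ (grow g _ _ _ _) = there (root∈ g)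

length-mono-⊆ : ∀ {A : Set} {xs ys : List A} → Unique xs → (∀ {z} → z ∈ xs → z ∈ ys) → length xs ≤ length ys
length-mono-⊆ [] _ = z≤n
length-mono-⊆ {xs = x ∷ xs} (x∉xs ∷ xs!) xs⊆ys with ∈-∃++ (xs⊆ys (here refl))
... | h , t , refl = begin
  suc (length xs)           ≤⟨ s≤s (length-mono-⊆ xs! xs⊆h++t) ⟩
  suc (length (h ++ t))     ≡⟨ cong suc (length-++ h) ⟩
  suc (length h + length t) ≡⟨ +-suc (length h) (length t) ⟨
  length h + length (x ∷ t) ≡⟨ length-++ h ⟨
  length (h ++ x ∷ t)       ∎
  where
  open ≤-Reasoning
  xs⊆h++t : ∀ {z} → z ∈ xs → z ∈ h ++ t
  xs⊆h++t z∈xs with ∈-++⁻ h (xs⊆ys (there z∈xs))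
  ... | inj₁ z∈h         = ∈-++⁺ˡ z∈h
  ... | inj₂ (here refl) = ⊥-elim (All.lookup x∉xs z∈xs refl)
  ... | inj₂ (there z∈t) = ∈-++⁺ʳ h z∈t

record SpanningGrowth (x₀ : ℕ) (r : V) (C : VSet) : Set where
  field
    blocks   : List V
    growth   : Growth x₀ r blocks
    sound    : ∀ {u} → u ∈ blocks → C u
    complete : ∀ {u} → C u → u ∈ blocks

_≟V_ : DecidableEquality V
_≟V_ = ≡-dec _≟_ _≟_

open import Data.List.Membership.DecPropositional _≟V_ using (_∈?_)

adj? : ∀ u w → Dec (Adj u w)
adj? (x₁ , y₁) (x₂ , y₂) = ∣ x₁ - x₂ ∣ + ∣ y₁ - y₂ ∣ ≟ 1

reach-start : ∀ {C u w} → Reach C u w → C u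
reach-start (here Cu)     = Cu
reach-start (step Cu _ _) = Cu

module _ {T C : VSet} (T? : Decidable T) {ts : List V} (T⊆ts : T ⊆ (_∈ ts)) (C-component : IsComponent T C)
         {x₀ : ℕ} (x₀≤ : ∀ {u} → C u → x₀ ≤ proj₁ u) where

  private
    C⊆T : C ⊆ T
    C⊆T = proj₁ C-component _

    C-closed : ∀ {u w} → C u → T w → Adj u w → C w
    C-closed = proj₂ (proj₂ (proj₂ C-component)) _ _

    Closed : List V → Set
    Closed L = ∀ {u w} → u ∈ L → Adj u w → T w → w ∈ L

    Exit : List V → Set
    Exit L = Any (λ u → Any (λ w → Adj u w × T w × w ∉ L) ts) L

    exit? : ∀ L → Dec (Exit L)
    exit? L = any? (λ u → any? (λ w → adj? u w ×-dec T? w ×-dec ¬? (w ∈? L)) ts) L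

    explore : ∀ {r} fuel {L} → Growth x₀ r L → (∀ {u} → u ∈ L → C u) → length ts < length L + fuel →
              ∃ λ L′ → Growth x₀ r L′ × (∀ {u} → u ∈ L′ → C u) × Closed L′
    explore zero {L} g L⊆C bound = ⊥-elim (<⇒≱ (subst (length ts <_) (+-identityʳ (length L)) bound) L≤ts)
      where
      L≤ts : length L ≤ length ts
      L≤ts = length-mono-⊆ (Growth⇒Unique g) (λ u∈L → T⊆ts (C⊆T (L⊆C u∈L)))
    explore (suc fuel) {L} g L⊆C bound with exit? L
    ... | yes exit with find exit
    ...   | u , u∈L , exitᵤ with find exitᵤ
    ...     | w , _ , (uw , Tw , w∉L) =
      explore fuel (grow g u∈L (Adj⇒Neighbour u w uw) w∉L (x₀≤ Cw)) wL⊆C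
              (subst (length ts <_) (+-suc (length L) fuel) bound)
      where
      Cw : C w
      Cw = C-closed (L⊆C u∈L) Tw uw
      wL⊆C : ∀ {v} → v ∈ w ∷ L → C v
      wL⊆C (here refl) = Cw
      wL⊆C (there v∈L) = L⊆C v∈L
    explore (suc fuel) {L} g L⊆C bound | no noExit = L , g , L⊆C , closed
      where
      closed : Closed L
      closed {u} {w} u∈L uw Tw with w ∈? L
      ... | yes w∈L = w∈L
      ... | no  w∉L = ⊥-elim (noExit (lose u∈L (lose (T⊆ts Tw) (uw , Tw , w∉L))))

  componentGrowth : ∀ {r} → C r → SpanningGrowth x₀ r C
  componentGrowth {r} Cr with explore (length ts) root (λ { (here refl) → Cr }) (n<1+n (length ts))
  ... | L , g , L⊆C , closed = record { blocks = L ; growth = g ; sound = L⊆C ; complete = complete }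
    where
    reach⇒∈ : ∀ {u w} → Reach C u w → u ∈ L → w ∈ L
    reach⇒∈ (here _)         u∈L = u∈L
    reach⇒∈ (step _ uv rest) u∈L = reach⇒∈ rest (closed u∈L uv (C⊆T (reach-start rest)))
    complete : ∀ {u} → C u → u ∈ L
    complete Cu = reach⇒∈ (proj₁ (proj₂ (proj₂ C-component)) _ _ Cr Cu) (root∈ g)

leftmost : ∀ {T C : VSet} {ts} → Decidable T → T ⊆ (_∈ ts) → IsComponent T C →
           ∃ λ r → C r × (∀ {u} → C u → proj₁ r ≤ proj₁ u)
leftmost {C = C} T? T⊆ts C-component@(_ , (c₀ , Cc₀) , _) = r , Cr , r≤
  where
  open SpanningGrowth (componentGrowth T? T⊆ts C-component (λ _ → z≤n) Cc₀)
  r : V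
  r = argmin proj₁ c₀ blocks
  Cr : C r
  Cr = argmin-all proj₁ Cc₀ (All.tabulate sound)
  r≤ : ∀ {u} → C u → proj₁ r ≤ proj₁ u
  r≤ Cu = All.lookup (f[argmin]≤f[xs] {f = proj₁} c₀ blocks) (complete Cu)

blowUp-hamiltonian : ∀ {T C : VSet} {ts} → Decidable T → T ⊆ (_∈ ts) → IsComponent T C →
                     IsPath (blowUp C) (blowUp C)
blowUp-hamiltonian T? T⊆ts C-component with leftmost T? T⊆ts C-component
... | r , Cr , r≤ =
  path , nonempty , unique , All.tabulate (λ u∈ → sound (block∈ u∈)) , Linked.map Neighbour⇒Adj linked ,
  λ u → mk⇔ (λ Cbu → ∈path (complete Cbu)) (λ u∈ → sound (block∈ u∈))
  where
  open SpanningGrowth (componentGrowth T? T⊆ts C-component r≤ Cr)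
  open BlockTour (Growth⇒BlockTour growth)

-- Transferring strategies

IsPath-mono : ∀ {S S′ P} → S ⊆ S′ → IsPath S P → IsPath S′ P
IsPath-mono S⊆S′ (p , p≢[] , p! , p⊆S , linked , P⇔p) = p , p≢[] , p! , All.map S⊆S′ p⊆S , linked , P⇔p

IsPath⇒Decidable : ∀ {S P} → IsPath S P → Decidable P
IsPath⇒Decidable (p , _ , _ , _ , _ , P⇔p) u = Dec.map (⇔-sym (P⇔p u)) (u ∈? p)

vcs≥⇒vp≥ : ∀ {T S : VSet} {ts} → T ⊆ (_∈ ts) → Decidable T → blowUp T ⊆ S → ∀ k → vcs≥ T k → vp≥ S k
vcs≥⇒vp≥ T⊆ts T? T⇑⊆S zero    _ = _
vcs≥⇒vp≥ {T} T⊆ts T? T⇑⊆S (suc k) (C , C-component , continue) =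
  blowUp C , IsPath-mono (λ Cbu → T⇑⊆S (C⊆T Cbu)) hamiltonian , respond
  where
  C⊆T : C ⊆ T
  C⊆T = proj₁ C-component _
  hamiltonian : IsPath (blowUp C) (blowUp C)
  hamiltonian = blowUp-hamiltonian T? T⊆ts C-component
  respond : ∀ v → blowUp C v → vp≥ (blowUp C ∖ v) k
  respond v Cbv = vcs≥⇒vp≥ (λ Cu → T⊆ts (C⊆T (proj₁ Cu))) C∖bv? shrink k (continue (block v) Cbv)
    where
    C∖bv? : Decidable (C ∖ block v)
    C∖bv? u = Decidable[blowUp]⇒Decidable (IsPath⇒Decidable hamiltonian) u ×-dec ¬? (u ≟V block v)
    shrink : blowUp (C ∖ block v) ⊆ blowUp C ∖ v
    shrink (Cbu , bu≢bv) = Cbu , λ u≡v → bu≢bv (cong block u≡v)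

gridList : ℕ → List V
gridList n = cartesianProduct (upTo n) (upTo n)

Grid⊆gridList : ∀ n → Grid n ⊆ (_∈ gridList n)
Grid⊆gridList n (x<n , y<n) = ∈-cartesianProduct⁺ (∈-upTo⁺ x<n) (∈-upTo⁺ y<n)

Grid? : ∀ n → Decidable (Grid n)
Grid? n (x , y) = x <? n ×-dec y <? n

⌊n/2⌋<k⇒n<double[k] : ∀ n k → ⌊ n /2⌋ < k → n < double k
⌊n/2⌋<k⇒n<double[k] zero          (suc k) _         = s≤s z≤n
⌊n/2⌋<k⇒n<double[k] (suc zero)    (suc k) _         = s≤s (s≤s z≤n)
⌊n/2⌋<k⇒n<double[k] (suc (suc n)) (suc k) (s≤s n<k) = s≤s (s≤s (⌊n/2⌋<k⇒n<double[k] n k n<k))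

double≡*2 : ∀ n → double n ≡ n * 2
double≡*2 zero    = refl
double≡*2 (suc n) = cong (λ m → suc (suc m)) (double≡*2 n)

blowUp-Grid : ∀ m → blowUp (Grid (m / 2)) ⊆ Grid m
blowUp-Grid m (⌊x/2⌋<m/2 , ⌊y/2⌋<m/2) = below ⌊x/2⌋<m/2 , below ⌊y/2⌋<m/2
  where
  double[m/2]≤m : double (m / 2) ≤ m
  double[m/2]≤m = ≤-trans (≤-reflexive (double≡*2 (m / 2))) (m/n*n≤m m 2)
  below : ∀ {n} → ⌊ n /2⌋ < m / 2 → n < m
  below {n} ⌊n/2⌋<m/2 = ≤-trans (⌊n/2⌋<k⇒n<double[k] n (m / 2) ⌊n/2⌋<m/2) double[m/2]≤m

proposition8 : ∀ (m : ℕ) → 1 < m → ∀ (k : ℕ) → vcs≥ (Grid (m / 2)) k → vp≥ (Grid m) k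
proposition8 m _ = vcs≥⇒vp≥ (Grid⊆gridList (m / 2)) (Grid? (m / 2)) (blowUp-Grid m)
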